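{- Let $D$ be a directed graph of odd degeneracy $k\geq 3$. Then $f(D)<\frac{k-1}{k+1}n(D)$.
   Context: Directed graphs are finite oriented graphs (no loops, multiple arcs or antiparallel arcs). A feedback vertex set of $D$ is a set of vertices whose deletion leaves no directed cycle; $f(D)$ is its minimum size and $n(D)$ the number of vertices. The degeneracy of $D$ is the least $k$ such that the underlying undirected graph has a vertex ordering in which each vertex has at most $k$ neighbours preceding it. -}

module Defs where

open import Data.Nat using (ℕ; zero; suc; _+_; _*_; _≤_; _<_; _<ᵇ_)
open import Data.Fin using (Fin; zero; suc; toℕ; inject₁; fromℕ)
open import Data.Fin.Subset using (Subset; _∈_)
open import Data.Fin.Permutation using (Permutation′; _⟨$⟩ʳ_)
open import Data.Bool using (Bool; true; false; _∧_; _∨_; if_then_else_)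
open import Data.List using (map; allFin)
open import Data.Nat.ListAction using (sum)
open import Data.Product using (Σ; ∃; _×_)
open import Relation.Binary.PropositionalEquality using (_≡_; _≢_)
open import Relation.Nullary using (¬_)
open import Function.Definitions using (Injective)

-- An oriented graph on the vertex set Fin n: the arc relation is a
-- Boolean matrix (so there are no multiple arcs), with no loops and
-- no antiparallel pairs of arcs.
record Digraph (n : ℕ) : Set where
  field
    arc          : Fin n → Fin n → Bool
    loopless     : ∀ v → arc v v ≡ false
    antiparallel : ∀ u v → arc u v ≡ true → arc v u ≡ false
open Digraph public

nV : ∀ {n} → Digraph n → ℕ
nV {n} _ = n

adj : ∀ {n} → Digraph n → Fin n → Fin n → Bool
adj D u v = arc D u v ∨ arc D v u

record DirectedCycle {n : ℕ} (D : Digraph n) : Set where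
  field
    len-1  : ℕ
    vtx    : Fin (suc len-1) → Fin n
    distinct : Injective _≡_ _≡_ vtx
    step   : ∀ (i : Fin len-1) → arc D (vtx (inject₁ i)) (vtx (suc i)) ≡ true
    close  : arc D (vtx (fromℕ len-1)) (vtx zero) ≡ true
open DirectedCycle public

IsFVS : ∀ {n} → Digraph n → Subset n → Set
IsFVS D S = ∀ (C : DirectedCycle D) → ∃ λ i → vtx C i ∈ S

-- number of neighbours of v that precede v in the ordering π
-- (π v is the position of v)
predCount : ∀ {n} → Digraph n → Permutation′ n → Fin n → ℕ
predCount {n} D π v =
  sum (map (λ u → if adj D u v ∧ (toℕ (π ⟨$⟩ʳ u) <ᵇ toℕ (π ⟨$⟩ʳ v)) then 1 else 0)
           (allFin n))

Degenerate≤ : ∀ {n} → Digraph n → ℕ → Set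
Degenerate≤ D k = ∃ λ π → ∀ v → predCount D π v ≤ k

HasDegeneracy : ∀ {n} → Digraph n → ℕ → Set
HasDegeneracy D k = Degenerate≤ D k × (∀ j → Degenerate≤ D j → k ≤ j)

Odd : ℕ → Set
Odd k = ∃ λ m → k ≡ suc (2 * m)

-- Write k = 2m + 1 and fix a vertex ordering in which every vertex has at
-- most k earlier neighbours. Scan the vertices from last to first, growing
-- a set F. When the scanned vertex v is not in F, its earlier in-neighbours
-- and its earlier out-neighbours outside F number at most 2m + 1 together,
-- so one of the two sides has at most m of them; add that whole side to F.
-- F meets every directed cycle: the last vertex v of a cycle is in F, or
-- its predecessor and successor on the cycle are both earlier neighbours,
-- one of them on the side added when v was scanned.
-- Every vertex kept outside F adds at most m vertices to F, and the last
-- kept vertex adds none: by then every earlier vertex is in F, so the other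
-- side had nothing outside F, and the chosen side was the smaller one.
-- Hence |F| + m ≤ m (n − |F|), which rearranges to |F| (k + 1) < (k − 1) n.
module Submission where

open import Defs
open import Data.Nat using (ℕ; _≤_; _<_; _*_; _∸_; suc)
open import Data.Fin.Subset using (Subset; ∣_∣)
open import Data.Product using (∃; _×_)

open import Algebra.Properties.CommutativeSemigroup using (interchange)
open import Data.Bool using (Bool; true; false; not; _∧_; _∨_; if_then_else_; T)
open import Data.Bool.Properties using (∨-zeroʳ; ∨-identityʳ; ∧-zeroʳ)
open import Data.Fin using (Fin; zero; suc; toℕ; fromℕ; fromℕ<; inject₁; lower₁)
open import Data.Fin.Properties using (toℕ<n; toℕ-fromℕ; toℕ-fromℕ<; toℕ-injective; inject₁-lower₁)
open import Data.Fin.Permutation using (Permutation′; _⟨$⟩ʳ_; _⟨$⟩ˡ_; inverseʳ)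
import Data.Fin.Permutation as Permutation
import Data.Fin.Subset as Subset
open import Data.List using (List; []; _∷_; map; length; allFin; tabulate)
open import Data.List.Extrema.Nat using (argmax; f[xs]≤f[argmax])
open import Data.List.Membership.Propositional using (_∈_)
open import Data.List.Membership.Propositional.Properties using (∈-allFin)
open import Data.List.Properties using (length-tabulate)
import Data.List.Relation.Unary.All as All
open import Data.List.Relation.Unary.Any using (here; there)
open import Data.Nat using (zero; _+_; z≤n; s≤s; z<s; _<ᵇ_)
open import Data.Nat.ListAction using (sum)
open import Data.Nat.Properties
open import Data.Nat.Solver using (module +-*-Solver)
open import Data.Product using (_,_; proj₂; map₂)
open import Data.Sum using (_⊎_; inj₁; inj₂)
import Data.Sum as Sum
import Data.Vec as Vec
open import Data.Vec.Properties using (lookup∘tabulate; lookup⇒[]=)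
open import Function using (_∘_; id)
open import Function.Bundles using (Injection)
open import Function.Properties.Inverse using (↔⇒↣)
open import Relation.Binary.PropositionalEquality
  using (_≡_; _≢_; refl; sym; trans; cong; cong₂; subst; ≢-sym)
open import Relation.Nullary using (yes; no; ¬_; contradiction)
open import Relation.Nullary.Decidable using (dec-true; dec-false)

open +-*-Solver using (solve; _:+_; _:*_; _:=_; con)

∧-trueˡ : ∀ {a b} → a ∧ b ≡ true → a ≡ true
∧-trueˡ {true} _ = refl
∧-trueˡ {false} ()

∧-trueʳ : ∀ {a b} → a ∧ b ≡ true → b ≡ true
∧-trueʳ {true} b≡true = b≡true
∧-trueʳ {false} ()

∧-true : ∀ {a b} → a ≡ true → b ≡ true → a ∧ b ≡ true
∧-true refl b≡true = b≡true

∨-trueˡ : ∀ {a} b → a ≡ true → a ∨ b ≡ true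
∨-trueˡ b refl = refl

∨-trueʳ : ∀ a {b} → b ≡ true → a ∨ b ≡ true
∨-trueʳ a refl = ∨-zeroʳ a

<ᵇ-true : ∀ {m n} → m < n → (m <ᵇ n) ≡ true
<ᵇ-true = dec-true (_ <? _)

<ᵇ-false : ∀ {m n} → ¬ m < n → (m <ᵇ n) ≡ false
<ᵇ-false = dec-false (_ <? _)

<ᵇ-sound : ∀ {m n} → (m <ᵇ n) ≡ true → m < n
<ᵇ-sound {m} {n} e = <ᵇ⇒< m n (subst T (sym e) _)

ind : Bool → ℕ
ind b = if b then 1 else 0

module _ {A : Set} where

  infix  4 _⊆_
  infixr 6 _∪_
  infixr 7 _∩_ _∖_

  _⊆_ : (A → Bool) → (A → Bool) → Set
  X ⊆ Y = ∀ {x} → X x ≡ true → Y x ≡ true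

  Disjoint : (A → Bool) → (A → Bool) → Set
  Disjoint X Y = ∀ {x} → X x ≡ true → Y x ≡ false

  _∪_ _∩_ _∖_ : (A → Bool) → (A → Bool) → A → Bool
  (X ∪ Y) x = X x ∨ Y x
  (X ∩ Y) x = X x ∧ Y x
  (X ∖ Y) x = X x ∧ not (Y x)

  ∁ : (A → Bool) → A → Bool
  ∁ X x = not (X x)

  ∅ : A → Bool
  ∅ _ = false

  ∪-least : ∀ {X Y Z} → X ⊆ Z → Y ⊆ Z → X ∪ Y ⊆ Z
  ∪-least {X} X⊆Z Y⊆Z {x} h with X x in e
  ... | true  = X⊆Z e
  ... | false = Y⊆Z h

  ∪-⊆-∪-∖ : ∀ {X Y} → X ∪ Y ⊆ X ∪ (Y ∖ X)
  ∪-⊆-∪-∖ {X} {x = x} h with X x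
  ... | true  = refl
  ... | false rewrite h = refl

  ∁-antitone : ∀ {X Y} → X ⊆ Y → ∁ Y ⊆ ∁ X
  ∁-antitone {X} X⊆Y {x} ¬Y with X x in e
  ... | false = refl
  ... | true  = contradiction (trans (sym (cong not (X⊆Y e))) ¬Y) λ ()

  ⊆⇒Disjoint-∁ : ∀ {Z B} → Z ⊆ B → Disjoint (∁ B) Z
  ⊆⇒Disjoint-∁ {Z} Z⊆B {x} ¬B with Z x in e
  ... | false = refl
  ... | true  = contradiction (trans (sym (cong not (Z⊆B e))) ¬B) λ ()

  ∖-monoˡ : ∀ {X Y S} → X ⊆ Y → X ∖ S ⊆ Y ∖ S
  ∖-monoˡ X⊆Y h = ∧-true (X⊆Y (∧-trueˡ h)) (∧-trueʳ h)

  ∖-⊆ : ∀ {X S} → X ∖ S ⊆ X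
  ∖-⊆ = ∧-trueˡ

  ∖-∪-disjoint : ∀ {X Z S} → Disjoint X Z → X ∖ S ⊆ X ∖ (S ∪ Z)
  ∖-∪-disjoint {Z = Z} {S} disj {x} h
    rewrite disj (∧-trueˡ h) | ∨-identityʳ (S x) = h

  ∖-⊆-∪ : ∀ {X B Z S} → X ⊆ B → X ∖ S ⊆ (Z ∖ S) ∪ (B ∖ (S ∪ Z))
  ∖-⊆-∪ {X} {B} {Z} {S} X⊆B {x} h with Z x
  ... | true  = ∨-trueˡ (B x ∧ not (S x ∨ true)) (∧-trueʳ {X x} h)
  ... | false rewrite ∨-identityʳ (S x) = ∧-true (X⊆B (∧-trueˡ h)) (∧-trueʳ h)

  count : (A → Bool) → List A → ℕ
  count X xs = sum (map (λ x → ind (X x)) xs)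

  count-∅ : ∀ xs → count ∅ xs ≡ 0
  count-∅ []       = refl
  count-∅ (_ ∷ xs) = count-∅ xs

  ind-mono : ∀ {a b} → (a ≡ true → b ≡ true) → ind a ≤ ind b
  ind-mono {false} _   = z≤n
  ind-mono {true} a⇒b rewrite a⇒b refl = ≤-refl

  count-mono : ∀ {X Y} → X ⊆ Y → ∀ xs → count X xs ≤ count Y xs
  count-mono X⊆Y []       = z≤n
  count-mono X⊆Y (x ∷ xs) = +-mono-≤ (ind-mono X⊆Y) (count-mono X⊆Y xs)

  count-mono-< : ∀ {X Y w xs} → X ⊆ Y → w ∈ xs → X w ≡ false → Y w ≡ true →
                 count X xs < count Y xs
  count-mono-< {xs = _ ∷ xs} X⊆Y (here refl) Xw Yw rewrite Xw | Yw = s≤s (count-mono X⊆Y xs)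
  count-mono-< X⊆Y (there w∈xs) Xw Yw =
    +-mono-≤-< (ind-mono X⊆Y) (count-mono-< X⊆Y w∈xs Xw Yw)

  count-∪ : ∀ X Y xs → count (X ∪ Y) xs ≤ count X xs + count Y xs
  count-∪ X Y []       = z≤n
  count-∪ X Y (x ∷ xs) =
    ≤-trans (+-mono-≤ (ind-∨ (X x) (Y x)) (count-∪ X Y xs))
            (≤-reflexive (interchange +-commutativeSemigroup
                            (ind (X x)) (ind (Y x)) (count X xs) (count Y xs)))
    where
      ind-∨ : ∀ a b → ind (a ∨ b) ≤ ind a + ind b
      ind-∨ false _ = ≤-refl
      ind-∨ true  _ = s≤s z≤n

  count-disjoint : ∀ {X Y} → Disjoint X Y → ∀ xs → count X xs + count Y xs ≡ count (X ∪ Y) xs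
  count-disjoint disj []                 = refl
  count-disjoint {X} {Y} disj (x ∷ xs) =
    trans (interchange +-commutativeSemigroup (ind (X x)) (count X xs) (ind (Y x)) (count Y xs))
          (cong₂ _+_ (ind-disjoint (X x) (Y x) (disj {x})) (count-disjoint disj xs))
    where
      ind-disjoint : ∀ a b → (a ≡ true → b ≡ false) → ind a + ind b ≡ ind (a ∨ b)
      ind-disjoint false _ _   = refl
      ind-disjoint true  _ a⇒¬b rewrite a⇒¬b refl = refl

  count-∁ : ∀ X xs → count X xs + count (∁ X) xs ≡ length xs
  count-∁ X []       = refl
  count-∁ X (x ∷ xs) with X x
  ... | true  = cong suc (count-∁ X xs)
  ... | false = trans (+-suc _ _) (cong suc (count-∁ X xs))

∣tabulate∣≡count : ∀ {n k} (X : Fin n → Bool) (g : Fin k → Fin n) →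
                   ∣ Vec.tabulate (X ∘ g) ∣ ≡ count X (tabulate g)
∣tabulate∣≡count {k = zero}  X g = refl
∣tabulate∣≡count {k = suc k} X g with X (g zero)
... | true  = cong suc (∣tabulate∣≡count X (g ∘ suc))
... | false = ∣tabulate∣≡count X (g ∘ suc)

∈-tabulate : ∀ {n} {X : Fin n → Bool} {v} → X v ≡ true → v Subset.∈ Vec.tabulate X
∈-tabulate {X = X} {v} e = lookup⇒[]= v _ (trans (lookup∘tabulate X v) e)

m+m≤1+2n⇒m≤n : ∀ {c m} → c + c ≤ suc (2 * m) → c ≤ m
m+m≤1+2n⇒m≤n {c} {m} h = m<1+n⇒m≤n (*-cancelˡ-< 2 c (suc m) (begin-strict
    2 * c       ≡⟨ cong (c +_) (+-identityʳ c) ⟩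
    c + c       ≤⟨ h ⟩
    suc (2 * m) <⟨ n<1+n _ ⟩
    2 + 2 * m   ≡⟨ sym (*-suc 2 m) ⟩
    2 * suc m   ∎))
  where open ≤-Reasoning

charge : ∀ {a m k k′} → a ≤ m * k → k < k′ → a + m ≤ m * k′
charge {a} {m} {k} {k′} a≤mk k<k′ = begin
  a + m       ≤⟨ +-monoˡ-≤ m a≤mk ⟩
  m * k + m   ≡⟨ +-comm (m * k) m ⟩
  m + m * k   ≡⟨ sym (*-suc m k) ⟩
  m * suc k   ≤⟨ *-monoʳ-≤ m k<k′ ⟩
  m * k′      ∎
  where open ≤-Reasoning

s+m≤m*a⇒s*[1+m]+m≤m*[s+a] : ∀ s a m → s + m ≤ m * a → s * suc m + m ≤ m * (s + a)
s+m≤m*a⇒s*[1+m]+m≤m*[s+a] s a m h = begin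
  s * suc m + m   ≡⟨ solve 2 (λ s m → s :* (con 1 :+ m) :+ m := (s :+ m) :+ m :* s) refl s m ⟩
  s + m + m * s   ≤⟨ +-monoˡ-≤ (m * s) h ⟩
  m * a + m * s   ≡⟨ sym (*-distribˡ-+ m a s) ⟩
  m * (a + s)     ≡⟨ cong (m *_) (+-comm a s) ⟩
  m * (s + a)     ∎
  where open ≤-Reasoning

s*[1+m]+m≤m*n⇒s*[2+2m]<2m*n : ∀ s {m n} → 0 < m → s * suc m + m ≤ m * n →
                               s * suc (suc (2 * m)) < 2 * m * n
s*[1+m]+m≤m*n⇒s*[2+2m]<2m*n s {m} {n} 0<m h = begin-strict
  s * suc (suc (2 * m))   ≡⟨ solve 2 (λ s m → s :* (con 2 :+ con 2 :* m)
                                            := con 2 :* (s :* (con 1 :+ m))) refl s m ⟩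
  2 * (s * suc m)         <⟨ m<m+n _ (≤-trans 0<m (m≤m+n m (m + 0))) ⟩
  2 * (s * suc m) + 2 * m ≡⟨ sym (*-distribˡ-+ 2 (s * suc m) m) ⟩
  2 * (s * suc m + m)     ≤⟨ *-monoʳ-≤ 2 h ⟩
  2 * (m * n)             ≡⟨ sym (*-assoc 2 m n) ⟩
  2 * m * n               ∎
  where open ≤-Reasoning

maximal-index : ∀ {k} (f : Fin (suc k) → ℕ) → ∃ λ i → ∀ j → f j ≤ f i
maximal-index f =
  argmax f zero (allFin _) ,
  λ j → All.lookup (f[xs]≤f[argmax] {f = f} zero (allFin _)) (∈-allFin j)

module _ {n} {D : Digraph n} (C : DirectedCycle D) where

  cycle-predecessor : ∀ i → ∃ λ j → arc D (vtx C j) (vtx C i) ≡ true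
  cycle-predecessor zero    = fromℕ (len-1 C) , close C
  cycle-predecessor (suc i) = inject₁ i , step C i

  cycle-successor : ∀ i → ∃ λ j → arc D (vtx C i) (vtx C j) ≡ true
  cycle-successor i with len-1 C ≟ toℕ i
  ... | yes last = zero ,
    subst (λ j → arc D (vtx C j) (vtx C zero) ≡ true)
          (toℕ-injective (trans (toℕ-fromℕ _) last)) (close C)
  ... | no ¬last = suc (lower₁ i ¬last) ,
    subst (λ j → arc D (vtx C j) (vtx C (suc (lower₁ i ¬last))) ≡ true)
          (inject₁-lower₁ i ¬last) (step C (lower₁ i ¬last))

module Greedy {n : ℕ} (D : Digraph n) (π : Permutation′ n) where

  VertexSet : Set
  VertexSet = Fin n → Bool

  vertices : List (Fin n)
  vertices = allFin n

  size : VertexSet → ℕ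
  size X = count X vertices

  pos : Fin n → ℕ
  pos v = toℕ (π ⟨$⟩ʳ v)

  pos-injective : ∀ {u v} → pos u ≡ pos v → u ≡ v
  pos-injective eq = Injection.injective (↔⇒↣ π) (toℕ-injective eq)

  vertexAt : (t : ℕ) → t < n → Fin n
  vertexAt t t<n = π ⟨$⟩ˡ fromℕ< t<n

  pos-vertexAt : ∀ t (t<n : t < n) → pos (vertexAt t t<n) ≡ t
  pos-vertexAt t t<n = trans (cong toℕ (inverseʳ π)) (toℕ-fromℕ< t<n)

  arc⇒≢ : ∀ {u v} → arc D u v ≡ true → u ≢ v
  arc⇒≢ {u} a refl = contradiction (trans (sym a) (loopless D u)) λ ()

  before : ℕ → VertexSet
  before t u = pos u <ᵇ t

  before-suc : ∀ {t} → before t ⊆ before (suc t)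
  before-suc {t} {u} e = <ᵇ-true {pos u} {suc t} (m<n⇒m<1+n (<ᵇ-sound {pos u} {t} e))

  earlierIn earlierOut earlierNbr : Fin n → VertexSet
  earlierIn  v = before (pos v) ∩ λ u → arc D u v
  earlierOut v = before (pos v) ∩ λ u → arc D v u
  earlierNbr v = (λ u → adj D u v) ∩ before (pos v)

  earlierIn⊆Nbr : ∀ {v} → earlierIn v ⊆ earlierNbr v
  earlierIn⊆Nbr {v} {u} h =
    ∧-true (∨-trueˡ (arc D v u) (∧-trueʳ {before (pos v) u} h)) (∧-trueˡ {b = arc D u v} h)

  earlierOut⊆Nbr : ∀ {v} → earlierOut v ⊆ earlierNbr v
  earlierOut⊆Nbr {v} {u} h =
    ∧-true (∨-trueʳ (arc D u v) (∧-trueʳ {before (pos v) u} h)) (∧-trueˡ {b = arc D v u} h)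

  earlier-disjoint : ∀ S v → Disjoint (earlierIn v ∖ S) (earlierOut v ∖ S)
  earlier-disjoint S v {u} h
    rewrite antiparallel D u v (∧-trueʳ {before (pos v) u} (∧-trueˡ {b = not (S u)} h))
          | ∧-zeroʳ (before (pos v) u) = refl

  earlier∖⊆Nbr∖ : ∀ S v → earlierIn v ∖ S ∪ earlierOut v ∖ S ⊆ earlierNbr v ∖ S
  earlier∖⊆Nbr∖ S v = ∪-least {X = earlierIn v ∖ S} {Y = earlierOut v ∖ S}
    (∖-monoˡ {X = earlierIn v} {S = S} earlierIn⊆Nbr)
    (∖-monoˡ {X = earlierOut v} {S = S} earlierOut⊆Nbr)

  side : VertexSet → Fin n → VertexSet
  side S v with size (earlierIn v ∖ S) ≤? size (earlierOut v ∖ S)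
  ... | yes _ = earlierIn v
  ... | no _  = earlierOut v

  Covered : VertexSet → Fin n → Set
  Covered F v = earlierIn v ⊆ F ⊎ earlierOut v ⊆ F

  Covered-mono : ∀ {F G v} → F ⊆ G → Covered F v → Covered G v
  Covered-mono F⊆G = Sum.map (λ c h → F⊆G (c h)) (λ c h → F⊆G (c h))

  side-covers : ∀ S v → Covered (side S v) v
  side-covers S v with size (earlierIn v ∖ S) ≤? size (earlierOut v ∖ S)
  ... | yes _ = inj₁ id
  ... | no _  = inj₂ id

  side⊆before : ∀ S v → side S v ⊆ before (pos v)
  side⊆before S v with size (earlierIn v ∖ S) ≤? size (earlierOut v ∖ S)
  ... | yes _ = ∧-trueˡ
  ... | no _  = ∧-trueˡ

  side-twice≤ : ∀ S v → size (side S v ∖ S) + size (side S v ∖ S) ≤ size (earlierNbr v ∖ S)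
  side-twice≤ S v = ≤-trans (side-twice≤in+out) (begin
    size (earlierIn v ∖ S) + size (earlierOut v ∖ S)  ≡⟨ count-disjoint (earlier-disjoint S v) vertices ⟩
    size (earlierIn v ∖ S ∪ earlierOut v ∖ S)         ≤⟨ count-mono (earlier∖⊆Nbr∖ S v) vertices ⟩
    size (earlierNbr v ∖ S)                            ∎)
    where
      open ≤-Reasoning
      side-twice≤in+out : size (side S v ∖ S) + size (side S v ∖ S) ≤
                          size (earlierIn v ∖ S) + size (earlierOut v ∖ S)
      side-twice≤in+out with size (earlierIn v ∖ S) ≤? size (earlierOut v ∖ S)
      ... | yes in≤out = +-monoʳ-≤ (size (earlierIn v ∖ S)) in≤out
      ... | no in≰out  = +-monoˡ-≤ (size (earlierOut v ∖ S)) (<⇒≤ (≰⇒> in≰out))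

  size-∪ : ∀ S Z → size (S ∪ Z) ≤ size S + size (Z ∖ S)
  size-∪ S Z =
    ≤-trans (count-mono {X = S ∪ Z} {Y = S ∪ Z ∖ S} (∪-⊆-∪-∖ {X = S} {Y = Z}) vertices)
            (count-∪ S (Z ∖ S) vertices)

  undecided kept : ℕ → VertexSet → ℕ
  undecided t S = size (before t ∖ S)
  kept      t S = size (∁ (before t) ∖ S)

  -- Twice the chosen side is at most both sides together, and the other side
  -- stays outside S ∪ side S v.
  side≤undecided : ∀ S v → size (side S v ∖ S) ≤ undecided (pos v) (S ∪ side S v)
  side≤undecided S v = +-cancelˡ-≤ c c _ (begin
    c + c                                                   ≤⟨ side-twice≤ S v ⟩
    size (earlierNbr v ∖ S)                                 ≤⟨ count-mono nbr⊆ vertices ⟩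
    size (side S v ∖ S ∪ before (pos v) ∖ (S ∪ side S v))   ≤⟨ count-∪ _ _ vertices ⟩
    c + undecided (pos v) (S ∪ side S v)                    ∎)
    where
      open ≤-Reasoning
      c = size (side S v ∖ S)
      nbr⊆ : earlierNbr v ∖ S ⊆ side S v ∖ S ∪ before (pos v) ∖ (S ∪ side S v)
      nbr⊆ = ∖-⊆-∪ {X = earlierNbr v} {B = before (pos v)} {Z = side S v} {S = S}
                       (λ {u} → ∧-trueʳ {adj D u v})

  visit : Fin n → VertexSet → VertexSet
  visit v S with S v
  ... | true  = S
  ... | false = S ∪ side S v

  -- greedy t _ S visits the vertices at positions t − 1, …, 1, 0, in this order.
  greedy : (t : ℕ) → t ≤ n → VertexSet → VertexSet
  greedy zero    _   S = S
  greedy (suc t) t<n S = greedy t (<⇒≤ t<n) (visit (vertexAt t t<n) S)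

  removed : VertexSet
  removed = greedy n ≤-refl ∅

  visit-⊇ : ∀ v S → S ⊆ visit v S
  visit-⊇ v S {u} h with S v
  ... | true  = h
  ... | false = ∨-trueˡ (side S v u) h

  ∪-side-covers : ∀ S v → Covered (S ∪ side S v) v
  ∪-side-covers S v = Covered-mono (λ {u} → ∨-trueʳ (S u)) (side-covers S v)

  greedy-⊇ : ∀ t t≤n S → S ⊆ greedy t t≤n S
  greedy-⊇ zero    _   S h = h
  greedy-⊇ (suc t) t<n S h = greedy-⊇ t _ _ (visit-⊇ _ S h)

  greedy-covers : ∀ t t≤n S v → pos v < t → greedy t t≤n S v ≡ false →
                  Covered (greedy t t≤n S) v
  greedy-covers (suc t) t<n S v v<1+t v∉F with m<1+n⇒m<n∨m≡n v<1+t
  ... | inj₁ v<t = greedy-covers t _ _ v v<t v∉F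
  ... | inj₂ pos≡t with pos-injective (trans pos≡t (sym (pos-vertexAt t t<n)))
  ...   | refl with S v in Sv
  ...     | true  = contradiction (trans (sym (greedy-⊇ t _ S Sv)) v∉F) λ ()
  ...     | false = Covered-mono (greedy-⊇ t _ (S ∪ side S v)) (∪-side-covers S v)

  ≤∧≢⇒before : ∀ {u v} → pos u ≤ pos v → u ≢ v → before (pos v) u ≡ true
  ≤∧≢⇒before u≤v u≢v = <ᵇ-true (≤∧≢⇒< u≤v (u≢v ∘ pos-injective))

  removed-feedback : IsFVS D (Vec.tabulate removed)
  removed-feedback C with maximal-index (pos ∘ vtx C)
  ... | i , top with removed (vtx C i) in vi
  ...   | true  = i , ∈-tabulate vi
  ...   | false = meets (greedy-covers n ≤-refl ∅ (vtx C i) (toℕ<n _) vi)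
    where
      meets : Covered removed (vtx C i) → ∃ λ j → vtx C j Subset.∈ Vec.tabulate removed
      meets (inj₁ in⊆F) with cycle-predecessor C i
      ... | j , a = j , ∈-tabulate (in⊆F (∧-true (≤∧≢⇒before (top j) (arc⇒≢ a)) a))
      meets (inj₂ out⊆F) with cycle-successor C i
      ... | j , a =
        j , ∈-tabulate (out⊆F (∧-true (≤∧≢⇒before (top j) (≢-sym (arc⇒≢ a))) a))

  undecided-initially : Fin n → 0 < undecided n ∅
  undecided-initially v₀ = subst (_< undecided n ∅) (count-∅ vertices)
    (count-mono-< {X = ∅} {Y = before n ∖ ∅} (λ ()) (∈-allFin v₀) refl
                  (∧-true (<ᵇ-true {pos v₀} (toℕ<n (π ⟨$⟩ʳ v₀))) refl))

  kept-suc≤ : ∀ t S → kept (suc t) S ≤ kept t S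
  kept-suc≤ t S = count-mono {X = ∁ (before (suc t)) ∖ S} {Y = ∁ (before t) ∖ S}
    (∖-monoˡ {X = ∁ (before (suc t))} {S = S} (∁-antitone {X = before t} (before-suc {t}))) vertices

  undecided-visited : ∀ {w S} → S w ≡ true → undecided (suc (pos w)) S ≤ undecided (pos w) S
  undecided-visited {w} {S} Sw = count-mono earlier vertices
    where
      earlier : before (suc (pos w)) ∖ S ⊆ before (pos w) ∖ S
      earlier {u} h = ∧-true (<ᵇ-true (≤∧≢⇒< (m<1+n⇒m≤n (<ᵇ-sound u<1+w)) u≢w)) u∉S
        where
          u<1+w : before (suc (pos w)) u ≡ true
          u<1+w = ∧-trueˡ {b = not (S u)} h
          u∉S : not (S u) ≡ true
          u∉S = ∧-trueʳ {before (suc (pos w)) u} h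
          u≢w : pos u ≢ pos w
          u≢w eq with pos-injective eq
          ... | refl = contradiction (trans (sym (cong not Sw)) u∉S) λ ()

  kept-unvisited : ∀ {w S} → S w ≡ false → kept (suc (pos w)) S < kept (pos w) (S ∪ side S w)
  kept-unvisited {w} {S} Sw =
    count-mono-< {X = ∁ (before (suc (pos w))) ∖ S} {Y = ∁ (before (pos w)) ∖ (S ∪ side S w)}
                 stays-kept (∈-allFin w) w-before w-kept
    where
      side-disjoint : Disjoint (∁ (before (pos w))) (side S w)
      side-disjoint {u} = ⊆⇒Disjoint-∁ {Z = side S w} (side⊆before S w) {u}
      stays-kept : ∁ (before (suc (pos w))) ∖ S ⊆ ∁ (before (pos w)) ∖ (S ∪ side S w)
      stays-kept h =
        ∖-∪-disjoint {X = ∁ (before (pos w))} {Z = side S w} {S = S} side-disjoint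
          (∖-monoˡ {X = ∁ (before (suc (pos w)))} {S = S}
                   (∁-antitone {X = before (pos w)} (before-suc {pos w})) h)
      w-before : (∁ (before (suc (pos w))) ∖ S) w ≡ false
      w-before rewrite <ᵇ-true (n<1+n (pos w)) = refl
      w-outside : side S w w ≡ false
      w-outside = side-disjoint (cong not (<ᵇ-false {pos w} (<-irrefl refl)))
      w-kept : (∁ (before (pos w)) ∖ (S ∪ side S w)) w ≡ true
      w-kept rewrite <ᵇ-false (<-irrefl {pos w} refl) | Sw | w-outside = refl

  module Cost (m : ℕ) (deg : ∀ v → predCount D π v ≤ suc (2 * m)) where

    side≤m : ∀ S v → size (side S v ∖ S) ≤ m
    side≤m S v = m+m≤1+2n⇒m≤n (begin
      size (side S v ∖ S) + size (side S v ∖ S) ≤⟨ side-twice≤ S v ⟩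
      size (earlierNbr v ∖ S)                   ≤⟨ count-mono {X = earlierNbr v ∖ S} {Y = earlierNbr v}
                                                                (∖-⊆ {X = earlierNbr v} {S}) vertices ⟩
      predCount D π v                           ≤⟨ deg v ⟩
      suc (2 * m)                               ∎)
      where open ≤-Reasoning

    -- Each kept vertex pays m for the removed ones; the second component
    -- says the last kept vertex pays nothing.
    Budget : ℕ → VertexSet → Set
    Budget t S = size S ≤ m * kept t S × (undecided t S ≡ 0 → size S + m ≤ m * kept t S)

    budget-start : Fin n → Budget n ∅
    budget-start v₀ = subst (_≤ m * kept n ∅) (sym (count-∅ vertices)) z≤n ,
                      λ none → contradiction none (m<n⇒n≢0 (undecided-initially v₀))

    budget-unvisited : ∀ {w S} → S w ≡ false → Budget (suc (pos w)) S →
                       Budget (pos w) (S ∪ side S w)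
    budget-unvisited {w} {S} Sw (paid , _) =
      ≤-trans (size-∪ S (side S w)) (≤-trans (+-monoʳ-≤ (size S) (side≤m S w)) paid′) ,
      λ none → ≤-trans (+-monoˡ-≤ m (no-growth none)) paid′
      where
        open ≤-Reasoning
        S′ = S ∪ side S w
        paid′ : size S + m ≤ m * kept (pos w) S′
        paid′ = charge paid (kept-unvisited Sw)
        no-growth : undecided (pos w) S′ ≡ 0 → size S′ ≤ size S
        no-growth none = begin
          size S′                         ≤⟨ size-∪ S (side S w) ⟩
          size S + size (side S w ∖ S)    ≤⟨ +-monoʳ-≤ (size S) (side≤undecided S w) ⟩
          size S + undecided (pos w) S′   ≡⟨ cong (size S +_) none ⟩
          size S + 0                      ≡⟨ +-identityʳ (size S) ⟩
          size S                          ∎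

    budget-visited : ∀ {w S} → S w ≡ true → Budget (suc (pos w)) S → Budget (pos w) S
    budget-visited {w} {S} Sw (paid , last) =
      ≤-trans paid (*-monoʳ-≤ m (kept-suc≤ _ S)) ,
      λ none → ≤-trans (last (n≤0⇒n≡0 (≤-trans (undecided-visited Sw) (≤-reflexive none))))
                       (*-monoʳ-≤ m (kept-suc≤ _ S))

    budget-visit : ∀ {t w S} → pos w ≡ t → Budget (suc t) S → Budget t (visit w S)
    budget-visit {w = w} {S} refl b with S w in Sw
    ... | true  = budget-visited Sw b
    ... | false = budget-unvisited Sw b

    greedy-budget : ∀ t t≤n S → Budget t S → Budget 0 (greedy t t≤n S)
    greedy-budget zero    _   S b = b
    greedy-budget (suc t) t<n S b =
      greedy-budget t _ _ (budget-visit (pos-vertexAt t t<n) b)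

    removed-size : Fin n → size removed * suc m + m ≤ m * n
    removed-size v₀ = subst (λ s → size removed * suc m + m ≤ m * s) all-vertices
      (s+m≤m*a⇒s*[1+m]+m≤m*[s+a] (size removed) (kept 0 removed) m
        (proj₂ (greedy-budget n ≤-refl ∅ (budget-start v₀)) (count-∅ vertices)))
      where
        all-vertices : size removed + kept 0 removed ≡ n
        all-vertices = trans (count-∁ removed vertices) (length-tabulate id)

feedback-vertex-set-bound : ∀ {n} (D : Digraph (suc n)) m → Degenerate≤ D (suc (2 * m)) →
  ∃ λ (F : Subset (suc n)) → IsFVS D F × ∣ F ∣ * suc m + m ≤ m * suc n
feedback-vertex-set-bound D m (π , deg) =
  Vec.tabulate removed , removed-feedback ,
  subst (λ s → s * suc m + m ≤ m * _) (sym (∣tabulate∣≡count removed id)) (removed-size zero)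
  where
    open Greedy D π
    open Cost m deg

proposition5p3 : ∀ {n} (D : Digraph n) (k : ℕ) →
    HasDegeneracy D k → Odd k → 3 ≤ k →
    ∃ λ (S : Subset n) → IsFVS D S × (∣ S ∣ * suc k < (k ∸ 1) * nV D)
proposition5p3 {zero} D k (_ , minimal) _ 3≤k =
  contradiction (≤-trans 3≤k (minimal 0 (Permutation.id , λ ()))) λ ()
proposition5p3 {suc n} D .(suc (2 * zero)) _ (zero , refl) (s≤s ())
proposition5p3 {suc n} D .(suc (2 * suc m)) (degenerate , _) (suc m , refl) _ =
  map₂ (λ {F} → map₂ (s*[1+m]+m≤m*n⇒s*[2+2m]<2m*n ∣ F ∣ z<s))
       (feedback-vertex-set-bound D (suc m) degenerate)
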